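{- Let $S\subseteq \mathbb{N}^d$ be a generalized numerical semigroup. The following are equivalent: (1) $|PF(S)|=1$; (2) $PF(S)=\{\mathbf{f}\}$ for some $\mathbf{f}$ having at least one odd component; (3) there exists $\mathbf{f}\in H(S)$ such that $\mathbf{f}-\mathbf{h}\in S$ for all $\mathbf{h}\in H(S)$.
   Context: A generalized numerical semigroup (GNS) is a submonoid $S\subseteq\mathbb{N}^d$ such that $H(S)=\mathbb{N}^d\setminus S$ is finite. The set of pseudo-Frobenius elements is $PF(S)=\{\mathbf{x}\in H(S)\mid \mathbf{x}+\mathbf{s}\in S \text{ for all } \mathbf{s}\in S\setminus\{\mathbf{0}\}\}$. -}

module Defs where

open import Level using (Level; suc; _⊔_)
open import Data.Nat using (ℕ)
open import Data.Nat.Divisibility using (_∣_)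
open import Data.Fin using (Fin)
open import Data.Vec using (Vec; replicate; zipWith; lookup)
open import Data.List using (List)
open import Data.List.Membership.Propositional using (_∈_)
open import Data.Product using (Σ; ∃; _×_; ∃-syntax)
open import Relation.Nullary using (¬_)
open import Relation.Unary using (Decidable)
open import Relation.Binary.PropositionalEquality using (_≡_)
open import Function.Bundles using (_⇔_)

Pt : ℕ → Set
Pt d = Vec ℕ d

𝟎 : ∀ {d} → Pt d
𝟎 {d} = replicate d 0

infixl 6 _⊕_
_⊕_ : ∀ {d} → Pt d → Pt d → Pt d
_⊕_ = zipWith Data.Nat._+_

record GNS (d : ℕ) : Set₁ where
  field
    _∈S : Pt d → Set
    _∈S? : Decidable _∈S
    zero∈S : 𝟎 ∈S
    +-closed : ∀ {x y} → x ∈S → y ∈S → (x ⊕ y) ∈S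
    -- finiteness of H(S) = ℕ^d ∖ S: it is enumerated by a list
    holeList : List (Pt d)
    holeList-spec : ∀ x → (¬ (x ∈S)) ⇔ (x ∈ holeList)

  Hole : Pt d → Set
  Hole x = ¬ (x ∈S)

  -- x - y ∈ S  (with x - y computed in ℤ^d): x = y + s for some s ∈ S
  DiffInS : Pt d → Pt d → Set
  DiffInS x y = ∃[ s ] (s ∈S × x ≡ y ⊕ s)

  PF : Pt d → Set
  PF x = Hole x × (∀ s → s ∈S → ¬ (s ≡ 𝟎) → (x ⊕ s) ∈S)


HasOddComponent : ∀ {d} → Pt d → Set
HasOddComponent {d} f = ∃[ i ] (¬ (2 ∣ lookup f i))

-- Write y ≥ₛ x when y − x ∈ S.  The heart of the proof is that every hole
-- lies ≥ₛ-below some pseudo-Frobenius element (`belowSomePF`): starting from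
-- a hole h, either h is pseudo-Frobenius or h + s is again a hole for some
-- s ∈ S ∖ {0}; climbing in this way strictly increases the total size of the
-- point, which is bounded on the finite set H(S), so the climb ends at a
-- pseudo-Frobenius element.  The theorem then follows:
--   (1) ⇒ (3)  the unique pseudo-Frobenius f lies above every hole;
--   (3) ⇒ (1)  such an f is pseudo-Frobenius (f + s is not a hole, since
--              f − (f + s) ∉ ℕ^d for s ≠ 0) and every pseudo-Frobenius g
--              equals f (otherwise f = g + (f − g) ∈ S);
--   (1) ⇒ (2)  if f = g + g then g ∈ S gives f ∈ S, and g ∈ H(S) gives
--              g = f − g ∈ S by (3);
--   (2) ⇒ (1)  immediate.
module Submission where

open import Defs
open import Data.Nat using (ℕ; zero; suc; _+_; _∸_; _≤_; _<_; _≟_; s≤s; z≤n)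
open import Data.Nat.Properties
  using (+-identityʳ; +-assoc; +-cancelˡ-≡; m+n≡0⇒m≡0; m+n∸m≡n; *-comm;
         m≤m+n; ≤-trans; m≤n+m; m<m+n; ∸-monoʳ-<; +-commutativeSemigroup)
open import Data.Nat.Divisibility using (_∣?_; divides)
open import Data.Nat.ListAction using (sum)
open import Algebra.Properties.CommutativeSemigroup +-commutativeSemigroup
  using (interchange)
import Data.Fin as Fin
open import Data.Vec using ([]; _∷_; zipWith; head; tail)
import Data.Vec as Vec
open import Data.Vec.Properties using (≡-dec; zipWith-assoc; zipWith-identityʳ)
open import Data.List using (List; _∷_; map)
open import Data.List.Membership.Propositional using (_∈_; find; lose)
open import Data.List.Relation.Unary.Any using (here; there; any?)
open import Data.Product using (_×_; ∃-syntax; _,_; proj₁)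
open import Data.Sum using (_⊎_; inj₁; inj₂)
open import Data.Empty using (⊥-elim)
open import Relation.Nullary using (¬_; Dec; yes; no)
open import Relation.Nullary.Decidable using (map′; _×-dec_; ¬?)
open import Relation.Binary.PropositionalEquality
open import Relation.Binary.Definitions using (DecidableEquality)
open import Induction.WellFounded using (Acc; acc)
open import Relation.Binary.Construct.On as On using ()
open import Data.Nat.Induction using (<-wellFounded)
open import Function.Base using (_on_)
open import Function.Bundles using (_⇔_; mk⇔; Equivalence)

_≟ₚ_ : ∀ {d} → DecidableEquality (Pt d)
_≟ₚ_ = ≡-dec _≟_

⊕-identityʳ : ∀ {d} (x : Pt d) → x ⊕ 𝟎 ≡ x
⊕-identityʳ = zipWith-identityʳ +-identityʳ

⊕-assoc : ∀ {d} (x y z : Pt d) → (x ⊕ y) ⊕ z ≡ x ⊕ (y ⊕ z)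
⊕-assoc = zipWith-assoc +-assoc

⊕-cancelˡ : ∀ {d} (x y z : Pt d) → x ⊕ y ≡ x ⊕ z → y ≡ z
⊕-cancelˡ [] [] [] _ = refl
⊕-cancelˡ (x ∷ xs) (y ∷ ys) (z ∷ zs) e =
  cong₂ _∷_ (+-cancelˡ-≡ x y z (cong head e)) (⊕-cancelˡ xs ys zs (cong tail e))

⊕≡𝟎⇒ˡ : ∀ {d} (x y : Pt d) → x ⊕ y ≡ 𝟎 → x ≡ 𝟎
⊕≡𝟎⇒ˡ [] [] _ = refl
⊕≡𝟎⇒ˡ (x ∷ xs) (y ∷ ys) e =
  cong₂ _∷_ (m+n≡0⇒m≡0 x (cong head e)) (⊕≡𝟎⇒ˡ xs ys (cong tail e))

⊕-absorb : ∀ {d} (f s t : Pt d) → f ≡ (f ⊕ s) ⊕ t → s ≡ 𝟎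
⊕-absorb f s t e = ⊕≡𝟎⇒ˡ s t (sym (⊕-cancelˡ f 𝟎 (s ⊕ t) f⊕𝟎≡f⊕[s⊕t]))
  where
  f⊕𝟎≡f⊕[s⊕t] : f ⊕ 𝟎 ≡ f ⊕ (s ⊕ t)
  f⊕𝟎≡f⊕[s⊕t] = trans (⊕-identityʳ f) (trans e (⊕-assoc f s t))

_⊖_ : ∀ {d} → Pt d → Pt d → Pt d
_⊖_ = zipWith _∸_

⊕-⊖ : ∀ {d} (h s : Pt d) → (h ⊕ s) ⊖ h ≡ s
⊕-⊖ [] [] = refl
⊕-⊖ (h ∷ hs) (s ∷ ss) = cong₂ _∷_ (m+n∸m≡n h s) (⊕-⊖ hs ss)

oddComponentOrDouble : ∀ {d} (v : Pt d) → HasOddComponent v ⊎ ∃[ g ] (v ≡ g ⊕ g)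
oddComponentOrDouble [] = inj₂ ([] , refl)
oddComponentOrDouble (x ∷ v) with 2 ∣? x
... | no 2∤x = inj₁ (Fin.zero , 2∤x)
... | yes (divides q x≡q*2) with oddComponentOrDouble v
...   | inj₁ (i , odd) = inj₁ (Fin.suc i , odd)
...   | inj₂ (g , v≡g⊕g) = inj₂ (q ∷ g , cong₂ _∷_ x≡q+q v≡g⊕g)
  where
  x≡q+q : x ≡ q + q
  x≡q+q = trans x≡q*2 (trans (*-comm q 2) (cong (q +_) (+-identityʳ q)))

size : ∀ {d} → Pt d → ℕ
size = Vec.sum

size-⊕ : ∀ {d} (x y : Pt d) → size (x ⊕ y) ≡ size x + size y
size-⊕ [] [] = refl
size-⊕ (x ∷ xs) (y ∷ ys) =
  trans (cong (x + y +_) (size-⊕ xs ys)) (interchange x y (size xs) (size ys))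

size≡0⇒𝟎 : ∀ {d} (x : Pt d) → size x ≡ 0 → x ≡ 𝟎
size≡0⇒𝟎 [] _ = refl
size≡0⇒𝟎 (zero ∷ v) e = cong (0 ∷_) (size≡0⇒𝟎 v e)

size-⊕-< : ∀ {d} (h s : Pt d) → ¬ s ≡ 𝟎 → size h < size (h ⊕ s)
size-⊕-< h s s≢𝟎 = subst (size h <_) (sym (size-⊕ h s)) (m<m+n (size h) 0<|s|)
  where
  0<|s| : 0 < size s
  0<|s| with size s in |s|≡
  ... | zero  = ⊥-elim (s≢𝟎 (size≡0⇒𝟎 s |s|≡))
  ... | suc _ = s≤s z≤n

∈⇒≤sum : ∀ {A : Set} (w : A → ℕ) {x : A} {xs : List A} → x ∈ xs → w x ≤ sum (map w xs)
∈⇒≤sum w {xs = y ∷ ys} (here refl) = m≤m+n (w y) _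
∈⇒≤sum w {xs = y ∷ ys} (there x∈ys) = ≤-trans (∈⇒≤sum w x∈ys) (m≤n+m _ (w y))

module _ {d : ℕ} (S : GNS d) where
  open GNS S

  StrictlyAbove : Pt d → Pt d → Set
  StrictlyAbove y h = ∃[ s ] (s ∈S × ¬ s ≡ 𝟎 × y ≡ h ⊕ s)

  -- The only candidate for y − h is y ⊖ h, which makes the relation decidable.
  strictlyAbove? : ∀ y h → Dec (StrictlyAbove y h)
  strictlyAbove? y h =
    map′ (λ (y≡ , t∈S , t≢𝟎) → y ⊖ h , t∈S , t≢𝟎 , y≡) canonical
         ((y ≟ₚ (h ⊕ (y ⊖ h))) ×-dec ((y ⊖ h) ∈S?) ×-dec ¬? ((y ⊖ h) ≟ₚ 𝟎))
    where
    canonical : ∀ {y} → StrictlyAbove y h →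
                (y ≡ h ⊕ (y ⊖ h)) × (y ⊖ h) ∈S × ¬ (y ⊖ h) ≡ 𝟎
    canonical (s , s∈S , s≢𝟎 , refl) rewrite ⊕-⊖ h s = refl , s∈S , s≢𝟎

  pfOrClimb : ∀ h → Hole h → PF h ⊎ ∃[ y ] (Hole y × StrictlyAbove y h)
  pfOrClimb h h∉S with any? (λ y → strictlyAbove? y h) holeList
  ... | yes found = let y , y∈H , above = find found
                    in inj₂ (y , Equivalence.from (holeList-spec y) y∈H , above)
  ... | no none = inj₁ (h∉S , h+s∈S)
    where
    h+s∈S : ∀ s → s ∈S → ¬ s ≡ 𝟎 → (h ⊕ s) ∈S
    h+s∈S s s∈S s≢𝟎 with (h ⊕ s) ∈S?
    ... | yes h+s∈S = h+s∈S
    ... | no h+s∉S  = ⊥-elim (none (lose (Equivalence.to (holeList-spec _) h+s∉S)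
                                         (s , s∈S , s≢𝟎 , refl)))

  holeSizeBound : ℕ
  holeSizeBound = sum (map size holeList)

  hole-size-≤ : ∀ {h} → Hole h → size h ≤ holeSizeBound
  hole-size-≤ h∉S = ∈⇒≤sum size (Equivalence.to (holeList-spec _) h∉S)

  -- Climbing order on holes: y ⊏ h when y leaves less room below the bound.
  slack : Pt d → ℕ
  slack x = holeSizeBound ∸ size x

  _⊏_ : Pt d → Pt d → Set
  _⊏_ = _<_ on slack

  climb-⊏ : ∀ {y h} → Hole y → StrictlyAbove y h → y ⊏ h
  climb-⊏ {h = h} y∉S (s , _ , s≢𝟎 , refl) =
    ∸-monoʳ-< (size-⊕-< h s s≢𝟎) (hole-size-≤ y∉S)

  diffInS-refl : ∀ x → DiffInS x x
  diffInS-refl x = 𝟎 , zero∈S , sym (⊕-identityʳ x)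

  diffInS-step : ∀ {f y h} → DiffInS f y → StrictlyAbove y h → DiffInS f h
  diffInS-step {h = h} (t , t∈S , f≡y⊕t) (s , s∈S , _ , refl) =
    s ⊕ t , +-closed s∈S t∈S , trans f≡y⊕t (⊕-assoc h s t)

  belowSomePF : ∀ h → Hole h → ∃[ f ] (PF f × DiffInS f h)
  belowSomePF h = climb h (On.wellFounded slack <-wellFounded h)
    where
    climb : ∀ h → Acc _⊏_ h → Hole h → ∃[ f ] (PF f × DiffInS f h)
    climb h (acc rec) h∉S with pfOrClimb h h∉S
    ... | inj₁ h-PF = h , h-PF , diffInS-refl h
    ... | inj₂ (y , y∉S , y-above-h) =
      let f , f-PF , f≥y = climb y (rec (climb-⊏ y∉S y-above-h)) y∉S
      in f , f-PF , diffInS-step f≥y y-above-h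

  SinglePF : Set
  SinglePF = ∃[ f ] (PF f × (∀ g → PF g → g ≡ f))

  SingleOddPF : Set
  SingleOddPF = ∃[ f ] ((∀ x → PF x ⇔ (x ≡ f)) × HasOddComponent f)

  DominatingHole : Set
  DominatingHole = ∃[ f ] (Hole f × (∀ h → Hole h → DiffInS f h))

  uniquePF-dominates : ∀ {f} → (∀ g → PF g → g ≡ f) → ∀ h → Hole h → DiffInS f h
  uniquePF-dominates unique h h∉S =
    let g , g-PF , g≥h = belowSomePF h h∉S
    in subst (λ g → DiffInS g h) (unique g g-PF) g≥h

  single⇒dominating : SinglePF → DominatingHole
  single⇒dominating (f , (f∉S , _) , unique) = f , f∉S , uniquePF-dominates unique

  dominating⇒single : DominatingHole → SinglePF
  dominating⇒single (f , f∉S , f≥h) = f , (f∉S , f+s∈S) , unique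
    where
    -- f + s cannot be a hole, as f − (f + s) ∉ S for s ≠ 0.
    f+s∈S : ∀ s → s ∈S → ¬ s ≡ 𝟎 → (f ⊕ s) ∈S
    f+s∈S s s∈S s≢𝟎 with (f ⊕ s) ∈S?
    ... | yes f+s∈S = f+s∈S
    ... | no f+s∉S  = let t , _ , f≡f+s+t = f≥h (f ⊕ s) f+s∉S
                      in ⊥-elim (s≢𝟎 (⊕-absorb f s t f≡f+s+t))
    -- A pseudo-Frobenius g ≠ f would give f = g + (f − g) ∈ S.
    unique : ∀ g → PF g → g ≡ f
    unique g (g∉S , g+s∈S) with f≥h g g∉S
    ... | t , t∈S , f≡g⊕t with t ≟ₚ 𝟎
    ...   | yes refl = sym (trans f≡g⊕t (⊕-identityʳ g))
    ...   | no t≢𝟎   = ⊥-elim (f∉S (subst _∈S (sym f≡g⊕t) (g+s∈S t t∈S t≢𝟎)))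

  -- A dominating hole f is not a double g + g: g ∈ S would give f ∈ S, and
  -- g ∉ S would give g = f − g ∈ S.
  dominating-odd : ∀ {f} → Hole f → (∀ h → Hole h → DiffInS f h) → HasOddComponent f
  dominating-odd {f} f∉S f≥h with oddComponentOrDouble f
  ... | inj₁ odd = odd
  ... | inj₂ (g , f≡g⊕g) with g ∈S?
  ...   | yes g∈S = ⊥-elim (f∉S (subst _∈S (sym f≡g⊕g) (+-closed g∈S g∈S)))
  ...   | no g∉S  = let t , t∈S , f≡g⊕t = f≥h g g∉S
                        t≡g = ⊕-cancelˡ g t g (trans (sym f≡g⊕t) f≡g⊕g)
                    in ⊥-elim (g∉S (subst _∈S t≡g t∈S))

  single⇒singleOdd : SinglePF → SingleOddPF
  single⇒singleOdd (f , f-PF , unique) =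
    f , (λ x → mk⇔ (unique x) λ { refl → f-PF })
      , dominating-odd (proj₁ f-PF) (uniquePF-dominates unique)

  singleOdd⇒single : SingleOddPF → SinglePF
  singleOdd⇒single (f , pf⇔≡f , _) =
    f , Equivalence.from (pf⇔≡f f) refl , λ g → Equivalence.to (pf⇔≡f g)

mainTheorem4 : ∀ {d : ℕ} (S : GNS d) →
    let open GNS S in
      ((∃[ f ] (PF f × (∀ g → PF g → g ≡ f)))
        ⇔ (∃[ f ] ((∀ x → PF x ⇔ (x ≡ f)) × HasOddComponent f)))
      ×
      ((∃[ f ] (PF f × (∀ g → PF g → g ≡ f)))
        ⇔ (∃[ f ] (Hole f × (∀ h → Hole h → DiffInS f h))))
mainTheorem4 S =
  mk⇔ (single⇒singleOdd S) (singleOdd⇒single S) ,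
  mk⇔ (single⇒dominating S) (dominating⇒single S)
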